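{- For every $\sigma\in\mathfrak S_n$, $\hat\imath(\sigma)=\mathrm{inv}(\sigma^\vee)$.
   Context: For $\sigma=\sigma_1\cdots\sigma_n\in\mathfrak S_n$, $\sigma^\vee$ is the permutation $\sigma_1\sigma_3\sigma_5\cdots\sigma_6\sigma_4\sigma_2$, i.e. the entries in odd positions in increasing order of position followed by the entries in even positions in decreasing order of position. $\mathrm{inv}(\tau)$ is the number of pairs $i<j$ with $\tau_i>\tau_j$. $\hat\imath(\sigma)=\sum_{i=1}^{n-1}\hat c_i(\sigma)$, where $\hat c_i(\sigma)$ is the number of $j>i$ with $\sigma_i>\sigma_j$ if $i$ is odd, and the number of $j>i$ with $\sigma_i<\sigma_j$ if $i$ is even. -}

module Defs where

open import Data.Nat using (ℕ; zero; suc; _+_; _<ᵇ_)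
open import Data.Bool using (Bool; true; false; if_then_else_)
open import Data.List using (List; []; _∷_; _++_; reverse; map)
open import Data.Fin using (Fin)
open import Data.Fin.Base using (toℕ)
open import Data.Fin.Permutation using (Permutation′; _⟨$⟩ʳ_)
open import Data.List using (allFin)

-- One-line notation σ₁σ₂⋯σₙ of a permutation (entries as naturals 0..n-1;
-- only relative order matters for inv and î).
word : ∀ {n} → Permutation′ n → List ℕ
word σ = map (λ i → toℕ (σ ⟨$⟩ʳ i)) (allFin _)

countLess : ℕ → List ℕ → ℕ
countLess a [] = 0
countLess a (x ∷ xs) = (if x <ᵇ a then 1 else 0) + countLess a xs

countGreater : ℕ → List ℕ → ℕ
countGreater a [] = 0
countGreater a (x ∷ xs) = (if a <ᵇ x then 1 else 0) + countGreater a xs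

inv : List ℕ → ℕ
inv [] = 0
inv (x ∷ xs) = countLess x xs + inv xs

-- odd/even-position entries, positions counted from 1
oddPos evenPos : List ℕ → List ℕ
oddPos [] = []
oddPos (x ∷ xs) = x ∷ evenPos xs
evenPos [] = []
evenPos (x ∷ xs) = oddPos xs

vee : List ℕ → List ℕ
vee w = oddPos w ++ reverse (evenPos w)

-- î: sum over positions i of ĉ_i; the flag says whether the current
-- position (1-based) is odd.  The term for i = n is 0 in either case,
-- so summing over all i equals summing over i ≤ n-1.
ihatFrom : Bool → List ℕ → ℕ
ihatFrom _ [] = 0
ihatFrom true (x ∷ xs) = countLess x xs + ihatFrom false xs
ihatFrom false (x ∷ xs) = countGreater x xs + ihatFrom true xs

ihat : List ℕ → ℕ
ihat = ihatFrom true

-- The identity holds for every word w of naturals, not only permutations,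
-- and is proved by induction on w, peeling off the first two letters.
-- Writing w = x y r, the word w^∨ has the recursive shape
--     vee (x ∷ y ∷ r) = x ∷ (vee r ++ [ y ]),
-- so inv(vee w) counts: the letters below x in (vee r ++ [y]), the
-- inversions of vee r, and the letters of vee r above y.  On the other
-- side î(w) = #{letters of y r below x} + #{letters of r above y} + î(r).
-- Since vee r is a rearrangement of r, and the counts "below a" / "above a"
-- only depend on the multiset of letters, the two sides agree by the
-- induction hypothesis î(r) = inv(vee r).
module Submission where

open import Defs
open import Data.Nat using (ℕ; _+_; _<ᵇ_)
open import Data.Nat.Properties using (+-comm; +-identityʳ; +-commutativeSemigroup)
open import Data.Nat.ListAction using (sum)
open import Data.Nat.ListAction.Properties using (sum-++; sum-↭)
open import Algebra.Properties.CommutativeSemigroup +-commutativeSemigroup using (interchange)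
open import Data.Bool using (if_then_else_)
open import Data.List using (List; []; _∷_; _++_; reverse; map; [_])
open import Data.List.Properties using (map-++; ++-assoc; unfold-reverse)
open import Data.List.Relation.Binary.Permutation.Propositional using (_↭_; prep; ↭-refl; ↭-sym; ↭-trans)
open import Data.List.Relation.Binary.Permutation.Propositional.Properties
  using (map⁺; ++-comm; ++⁺ˡ; ↭-reverse)
open import Data.Fin.Permutation using (Permutation′)
open import Relation.Binary.PropositionalEquality using (_≡_; refl; cong; cong₂; module ≡-Reasoning)

tally : (ℕ → ℕ) → List ℕ → ℕ
tally f xs = sum (map f xs)

tally-++ : ∀ f xs ys → tally f (xs ++ ys) ≡ tally f xs + tally f ys
tally-++ f xs ys = begin
  sum (map f (xs ++ ys))       ≡⟨ cong sum (map-++ f xs ys) ⟩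
  sum (map f xs ++ map f ys)   ≡⟨ sum-++ (map f xs) (map f ys) ⟩
  tally f xs + tally f ys      ∎
  where open ≡-Reasoning

tally-↭ : ∀ f {xs ys} → xs ↭ ys → tally f xs ≡ tally f ys
tally-↭ f p = sum-↭ (map⁺ f p)

countLess-tally : ∀ a xs → countLess a xs ≡ tally (λ x → if x <ᵇ a then 1 else 0) xs
countLess-tally a [] = refl
countLess-tally a (x ∷ xs) = cong (_ +_) (countLess-tally a xs)

countGreater-tally : ∀ a xs → countGreater a xs ≡ tally (λ x → if a <ᵇ x then 1 else 0) xs
countGreater-tally a [] = refl
countGreater-tally a (x ∷ xs) = cong (_ +_) (countGreater-tally a xs)

countLess-++ : ∀ a xs ys → countLess a (xs ++ ys) ≡ countLess a xs + countLess a ys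
countLess-++ a xs ys = begin
  countLess a (xs ++ ys)          ≡⟨ countLess-tally a (xs ++ ys) ⟩
  tally _ (xs ++ ys)              ≡⟨ tally-++ _ xs ys ⟩
  tally _ xs + tally _ ys         ≡˘⟨ cong₂ _+_ (countLess-tally a xs) (countLess-tally a ys) ⟩
  countLess a xs + countLess a ys ∎
  where open ≡-Reasoning

countLess-↭ : ∀ a {xs ys} → xs ↭ ys → countLess a xs ≡ countLess a ys
countLess-↭ a {xs} {ys} p = begin
  countLess a xs   ≡⟨ countLess-tally a xs ⟩
  tally _ xs       ≡⟨ tally-↭ _ p ⟩
  tally _ ys       ≡˘⟨ countLess-tally a ys ⟩
  countLess a ys   ∎
  where open ≡-Reasoning

countGreater-↭ : ∀ a {xs ys} → xs ↭ ys → countGreater a xs ≡ countGreater a ys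
countGreater-↭ a {xs} {ys} p = begin
  countGreater a xs   ≡⟨ countGreater-tally a xs ⟩
  tally _ xs          ≡⟨ tally-↭ _ p ⟩
  tally _ ys          ≡˘⟨ countGreater-tally a ys ⟩
  countGreater a ys   ∎
  where open ≡-Reasoning

oddPos++evenPos-↭ : ∀ xs → oddPos xs ++ evenPos xs ↭ xs
oddPos++evenPos-↭ [] = ↭-refl
oddPos++evenPos-↭ (x ∷ xs) =
  prep x (↭-trans (++-comm (evenPos xs) (oddPos xs)) (oddPos++evenPos-↭ xs))

vee-↭ : ∀ xs → vee xs ↭ xs
vee-↭ xs = ↭-trans (++⁺ˡ (oddPos xs) (↭-reverse (evenPos xs))) (oddPos++evenPos-↭ xs)

vee-cons-cons : ∀ x y r → vee (x ∷ y ∷ r) ≡ x ∷ (vee r ++ [ y ])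
vee-cons-cons x y r = cong (x ∷_) (begin
  oddPos r ++ reverse (y ∷ evenPos r)      ≡⟨ cong (oddPos r ++_) (unfold-reverse y (evenPos r)) ⟩
  oddPos r ++ (reverse (evenPos r) ++ [ y ]) ≡˘⟨ ++-assoc (oddPos r) (reverse (evenPos r)) [ y ] ⟩
  vee r ++ [ y ]                           ∎)
  where open ≡-Reasoning

inv-snoc : ∀ L y → inv (L ++ [ y ]) ≡ inv L + countGreater y L
inv-snoc [] y = refl
inv-snoc (x ∷ L) y = begin
  countLess x (L ++ [ y ]) + inv (L ++ [ y ])
    ≡⟨ cong₂ _+_ (countLess-++ x L [ y ]) (inv-snoc L y) ⟩
  (countLess x L + (y<x + 0)) + (inv L + countGreater y L)
    ≡⟨ cong (λ k → (countLess x L + k) + (inv L + countGreater y L)) (+-identityʳ y<x) ⟩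
  (countLess x L + y<x) + (inv L + countGreater y L)
    ≡⟨ interchange (countLess x L) y<x (inv L) (countGreater y L) ⟩
  (countLess x L + inv L) + (y<x + countGreater y L)
    ∎
  where
    open ≡-Reasoning
    y<x : ℕ
    y<x = if y <ᵇ x then 1 else 0

ihat≡inv∘vee : ∀ w → ihat w ≡ inv (vee w)
ihat≡inv∘vee [] = refl
ihat≡inv∘vee (x ∷ []) = refl
ihat≡inv∘vee (x ∷ y ∷ r) = begin
  countLess x (y ∷ r) + (countGreater y r + ihat r)
    ≡⟨ cong (countLess x (y ∷ r) +_) (+-comm (countGreater y r) (ihat r)) ⟩
  countLess x (y ∷ r) + (ihat r + countGreater y r)
    ≡⟨ cong₂ _+_ (countLess-↭ x (↭-sym vee-r+y↭y∷r))
                 (cong₂ _+_ (ihat≡inv∘vee r) (countGreater-↭ y (↭-sym (vee-↭ r)))) ⟩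
  countLess x (vee r ++ [ y ]) + (inv (vee r) + countGreater y (vee r))
    ≡˘⟨ cong (countLess x (vee r ++ [ y ]) +_) (inv-snoc (vee r) y) ⟩
  inv (x ∷ (vee r ++ [ y ]))
    ≡˘⟨ cong inv (vee-cons-cons x y r) ⟩
  inv (vee (x ∷ y ∷ r))
    ∎
  where
    open ≡-Reasoning
    vee-r+y↭y∷r : vee r ++ [ y ] ↭ y ∷ r
    vee-r+y↭y∷r = ↭-trans (++-comm (vee r) [ y ]) (prep y (vee-↭ r))

proposition3p6 : (n : ℕ) (σ : Permutation′ n) → ihat (word σ) ≡ inv (vee (word σ))
proposition3p6 n σ = ihat≡inv∘vee (word σ)
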